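{- There is no binary operator $>$ such that the language obtained by adding $>$ to the language generated by $\bot,\wedge,\to,\curlyvee,\Diamond^{+}$ is convex and satisfies both Modus Ponens and the Deduction Theorem for $>$.
   Context: Team semantics setting: a valuation is a function $v:Prop\to\{0,1\}$ over a finite set $Prop$ of propositional variables (formulas are built from $p\in Prop$), and a team is a set of valuations. Semantics: $T\models p$ iff $v(p)=1$ for all $v\in T$; $T\models\bot$ iff $T=\emptyset$; $T\models\varphi\wedge\psi$ iff $T\models\varphi$ and $T\models\psi$; $T\models\varphi\to\psi$ iff for all $S\subseteq T$, $S\models\varphi$ implies $S\models\psi$; $T\models\varphi\curlyvee\psi$ (outer global disjunction) iff there exists $S\supseteq T$ with $S\models\varphi$ or $S\models\psi$; $T\models\Diamond^{+}\varphi$ (epistemic might) iff there is a nonempty $S\subseteq T$ with $S\models\varphi$. A formula $\varphi$ is convex if $S\models\varphi$, $T\models\varphi$ and $S\subseteq R\subseteq T$ imply $R\models\varphi$; a language is convex if all its formulas are. Modus Ponens for $>$: $\varphi,\varphi>\psi\models\psi$ for all formulas $\varphi,\psi$ of the language. Deduction Theorem for $>$: if $\Gamma,\varphi\models\psi$ then $\Gamma\models\varphi>\psi$, for all formulas of the language. ($\Gamma\models\psi$ means every team satisfying all of $\Gamma$ satisfies $\psi$.) -}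

module Defs where

open import Data.Nat using (ℕ)
open import Data.Fin using (Fin)
open import Data.Bool using (Bool; true; false)
open import Data.Product using (Σ; _×_)
open import Data.Sum using (_⊎_)
open import Relation.Binary.PropositionalEquality using (_≡_)

Val : ℕ → Set
Val m = Fin m → Bool

-- A team is a set of valuations (given by its characteristic function;
-- the set of valuations is finite, so this is the set of all teams).
Team : ℕ → Set
Team m = Val m → Bool

_⊆_ : ∀ {m} → Team m → Team m → Set
S ⊆ T = ∀ v → S v ≡ true → T v ≡ true

Empty : ∀ {m} → Team m → Set
Empty T = ∀ v → T v ≡ false

NonEmpty : ∀ {m} → Team m → Set
NonEmpty T = Σ _ λ v → T v ≡ true

TProp : ℕ → Set₁
TProp m = Team m → Set

BinOp : ℕ → Set₁
BinOp m = TProp m → TProp m → TProp m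

infixr 6 _∧'_
infixr 5 _⋎_
infixr 4 _⇒_ _>'_
data Fml (m : ℕ) : Set where
  var  : Fin m → Fml m
  ⊥'   : Fml m
  _∧'_ : Fml m → Fml m → Fml m
  _⇒_  : Fml m → Fml m → Fml m
  _⋎_  : Fml m → Fml m → Fml m
  ◇⁺   : Fml m → Fml m
  _>'_ : Fml m → Fml m → Fml m

Sat : ∀ {m} → BinOp m → Fml m → Team m → Set
Sat G (var p) T = ∀ v → T v ≡ true → v p ≡ true
Sat G ⊥' T = Empty T
Sat G (φ ∧' ψ) T = Sat G φ T × Sat G ψ T
Sat G (φ ⇒ ψ) T = ∀ S → S ⊆ T → Sat G φ S → Sat G ψ S
Sat G (φ ⋎ ψ) T = Σ (Team _) λ S → T ⊆ S × (Sat G φ S ⊎ Sat G ψ S)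
Sat G (◇⁺ φ) T = Σ (Team _) λ S → S ⊆ T × NonEmpty S × Sat G φ S
Sat G (φ >' ψ) T = G (Sat G φ) (Sat G ψ) T

FSet : ℕ → Set₁
FSet m = Fml m → Set

_,,_ : ∀ {m} → FSet m → Fml m → FSet m
(Γ ,, φ) χ = Γ χ ⊎ χ ≡ φ

Entails : ∀ {m} → BinOp m → FSet m → Fml m → Set
Entails G Γ ψ = ∀ T → (∀ χ → Γ χ → Sat G χ T) → Sat G ψ T

Convex : ∀ {m} → BinOp m → Set
Convex G = ∀ φ (S R T : Team _) → Sat G φ S → Sat G φ T → S ⊆ R → R ⊆ T → Sat G φ R

ModusPonens : ∀ {m} → BinOp m → Set
ModusPonens G = ∀ φ ψ → Entails G (λ χ → χ ≡ φ ⊎ χ ≡ (φ >' ψ)) ψ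

DeductionTheorem : ∀ {m} → BinOp m → Set₁
DeductionTheorem G = ∀ (Γ : FSet _) φ ψ → Entails G (Γ ,, φ) ψ → Entails G Γ (φ >' ψ)

{-# OPTIONS --safe #-}
module Submission where

-- Both ⊥, p ⊨ ⊥ and ◇⁺¬p, p ⊨ ⊥ hold, so by the Deduction Theorem p > ⊥ is
-- satisfied by the empty team and by the full team (which satisfies ◇⁺¬p).
-- Convexity then gives p > ⊥ on the team of all valuations making p true,
-- and Modus Ponens forces that nonempty team to satisfy ⊥.

open import Defs
open import Data.Nat using (ℕ; suc)
open import Data.Fin using (Fin; zero)
open import Data.Bool using (true; false; not)
open import Data.Product using (_×_; _,_)
open import Data.Sum using (_⊎_; inj₁; inj₂)
open import Data.Empty using (⊥; ⊥-elim)
open import Relation.Nullary using (¬_)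
open import Relation.Binary.PropositionalEquality using (_≡_; refl; sym; trans)

true≢false : true ≡ false → ⊥
true≢false ()

module _ {m : ℕ} where

  ¬'_ : Fml m → Fml m
  ¬' φ = φ ⇒ ⊥'

  emptyTeam fullTeam : Team m
  emptyTeam _ = false
  fullTeam _ = true

  truthSet falsitySet : Fin m → Team m
  truthSet x v = v x
  falsitySet x v = not (v x)

  emptyTeam-⊆ : ∀ T → emptyTeam ⊆ T
  emptyTeam-⊆ T v ()

  ⊆-fullTeam : ∀ T → T ⊆ fullTeam
  ⊆-fullTeam T v _ = refl

module Refutation {m : ℕ} (G : BinOp m) where

  var-downwardClosed : ∀ x {S T} → S ⊆ T → Sat G (var x) T → Sat G (var x) S
  var-downwardClosed x S⊆T T⊨x v Sv = T⊨x v (S⊆T v Sv)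

  var-empty-on-falsitySet : ∀ x {U} → U ⊆ falsitySet x → Sat G (var x) U → Empty U
  var-empty-on-falsitySet x {U} U⊆F U⊨x w with U w in Uw
  ... | false = refl
  ... | true with w x | U⊨x w Uw | U⊆F w Uw
  ...   | true  | _  | ()
  ...   | false | () | _

  falsitySet-sat-¬var : ∀ x → Sat G (¬' var x) (falsitySet x)
  falsitySet-sat-¬var x U U⊆F = var-empty-on-falsitySet x U⊆F

  fullTeam-sat-◇⁺¬var : ∀ x → Sat G (◇⁺ (¬' var x)) fullTeam
  fullTeam-sat-◇⁺¬var x =
    falsitySet x , ⊆-fullTeam (falsitySet x) , ((λ _ → false) , refl) , falsitySet-sat-¬var x

  ⊥-var-entails-⊥ : ∀ x → Entails G ((_≡ ⊥') ,, var x) ⊥'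
  ⊥-var-entails-⊥ x T T⊨Γ = T⊨Γ ⊥' (inj₁ refl)

  ◇⁺¬var-var-entails-⊥ : ∀ x → Entails G ((_≡ ◇⁺ (¬' var x)) ,, var x) ⊥'
  ◇⁺¬var-var-entails-⊥ x T T⊨Γ with T⊨Γ (◇⁺ (¬' var x)) (inj₁ refl)
  ... | S , S⊆T , (v , Sv) , S⊨¬x = ⊥-elim (true≢false (trans (sym Sv) (S-empty v)))
    where
    S-empty : Empty S
    S-empty = S⊨¬x S (λ _ s → s) (var-downwardClosed x S⊆T (T⊨Γ (var x) (inj₂ refl)))

  deduce-from-single : DeductionTheorem G → ∀ {γ} φ ψ {T} →
                       Entails G ((_≡ γ) ,, φ) ψ → Sat G γ T → Sat G (φ >' ψ) T
  deduce-from-single dt {γ} φ ψ {T} γ,φ⊨ψ T⊨γ =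
    dt (_≡ γ) φ ψ γ,φ⊨ψ T λ { _ refl → T⊨γ }

  emptyTeam-sat-var>⊥ : DeductionTheorem G → ∀ x → Sat G (var x >' ⊥') emptyTeam
  emptyTeam-sat-var>⊥ dt x = deduce-from-single dt (var x) ⊥' (⊥-var-entails-⊥ x) (λ _ → refl)

  fullTeam-sat-var>⊥ : DeductionTheorem G → ∀ x → Sat G (var x >' ⊥') fullTeam
  fullTeam-sat-var>⊥ dt x = deduce-from-single dt (var x) ⊥' (◇⁺¬var-var-entails-⊥ x) (fullTeam-sat-◇⁺¬var x)

  truthSet-refutes-var>⊥ : ModusPonens G → ∀ x → ¬ Sat G (var x >' ⊥') (truthSet x)
  truthSet-refutes-var>⊥ mp x sat = true≢false (mp (var x) ⊥' (truthSet x) premises (λ _ → true))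
    where
    premises : ∀ χ → χ ≡ var x ⊎ χ ≡ (var x >' ⊥') → Sat G χ (truthSet x)
    premises _ (inj₁ refl) _ xv = xv
    premises _ (inj₂ refl) = sat

theorem2 : (n : ℕ) (G : BinOp (suc n)) → ¬ (Convex G × ModusPonens G × DeductionTheorem G)
theorem2 n G (convex , mp , dt) =
  truthSet-refutes-var>⊥ mp p
    (convex (var p >' ⊥') emptyTeam (truthSet p) fullTeam
      (emptyTeam-sat-var>⊥ dt p)
      (fullTeam-sat-var>⊥ dt p)
      (emptyTeam-⊆ (truthSet p))
      (⊆-fullTeam (truthSet p)))
  where
  open Refutation G
  p : Fin (suc n)
  p = zero
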